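{- Let $p\ge 2$ and let $a=(a_n)_{n\ge1}$ be a $p$-automatic sequence whose alphabet is a subset of a commutative ring $R$, and let $L(a,x)=\sum_{n\ge1}a_nx^{\ell(n)}\in R[[x]]$, where $\ell(n)$ is the number of digits of $n$ in base $p$. Let $A$ be the adjacency matrix of $\Gamma(a)$, indexed by $N(a)\times N(a)$, with $A_{u,v}$ equal to the number of $i\in\{0,\dots,p-1\}$ such that $u^{t_i}=v$, and let $T$ be the column vector indexed by $N(a)$ with $T_u=u_1+u_2+\cdots+u_{p-1}$. Then $L(a,x)$ is a rational fraction, namely the entry indexed by $a$ of the column vector $(I-xA)^{ -1}xT$ (expanded as a power series in $x$).
   Context: Sequences are indexed from $n=1$. A $p$-automaton consists of a finite set of states, an initial state, a labeling map to a finite alphabet, and for each state and each $i\in\{0,\dots,p-1\}$ exactly one outgoing arrow labeled $i$; it produces $(a_n)_{n\ge1}$ where $a_n$ is the label of the state reached from the initial state by following the arrows labeled by the base-$p$ digits of $n$, read from right (least significant) to left. A sequence is $p$-automatic if some $p$-automaton produces it. For integers $i,j\ge0$ with $j<p^i$, $a^{(i,j)}=(a_{p^in+j})_{n\ge1}$ and $N(a)=\{a^{(i,j)}\}$ (finite for automatic $a$). For $u\in N(a)$ and $0\le i<p$, $u^{t_i}=(u_{pn+i})_{n\ge1}$. $\Gamma(a)$ is the labeled directed graph with vertex set $N(a)$ and an arrow labeled $i$ from $u$ to $u^{t_i}$. -}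

module Defs where

open import Level using (Level; _⊔_)
open import Algebra.Bundles using (CommutativeRing)
open import Data.Nat using (ℕ; zero; suc; _+_; _*_; _^_; _<_; _≤_; NonZero)
open import Data.Nat.DivMod using (_/_; _mod_)
open import Data.Fin using (Fin; toℕ) renaming (zero to fzero; suc to fsuc)
open import Data.Fin.Properties using (_≟_)
open import Data.List using (List; []; _∷_)
open import Data.Product using (Σ; ∃; _×_; _,_)
open import Relation.Nullary using (does)
open import Data.Bool using (if_then_else_)
open import Relation.Binary.PropositionalEquality using (_≡_)

-- Base-p digits (least significant first) and number of digits ℓ(n).
-- Fuel n suffices since n / p < n for n ≥ 1 and p ≥ 2.

digitsFuel : (p : ℕ) .{{_ : NonZero p}} → ℕ → ℕ → List (Fin p)
digitsFuel p zero    n       = []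
digitsFuel p (suc f) zero    = []
digitsFuel p (suc f) (suc n) = (suc n mod p) ∷ digitsFuel p f (suc n / p)

digits : (p : ℕ) .{{_ : NonZero p}} → ℕ → List (Fin p)
digits p n = digitsFuel p n n

lenFuel : (p : ℕ) .{{_ : NonZero p}} → ℕ → ℕ → ℕ
lenFuel p zero    n       = 0
lenFuel p (suc f) zero    = 0
lenFuel p (suc f) (suc n) = suc (lenFuel p f (suc n / p))

-- ℓ(n) = number of base-p digits of n (ℓ(0) = 0, never used).
numDigits : (p : ℕ) .{{_ : NonZero p}} → ℕ → ℕ
numDigits p n = lenFuel p n n

record Automaton {c : Level} (p : ℕ) (Lab : Set c) : Set c where
  field
    m     : ℕ
    init  : Fin m
    label : Fin m → Lab
    δ     : Fin m → Fin p → Fin m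

  run : Fin m → List (Fin p) → Fin m
  run q []       = q
  run q (d ∷ ds) = run (δ q d) ds

  -- a_n: read the base-p digits of n from least to most significant
  output : .{{_ : NonZero p}} → ℕ → Lab
  output n = label (run init (digits p n))

countIdx : {p K : ℕ} → (Fin p → Fin K) → Fin K → ℕ
countIdx {zero}  s l = 0
countIdx {suc p} s l = (if does (s fzero ≟ l) then 1 else 0) + countIdx {p} (λ i → s (fsuc i)) l

module _ {c ℓ : Level} (R : CommutativeRing c ℓ) where
  open CommutativeRing R using (Carrier; _≈_; 0#; 1#) renaming (_+_ to _+R_; _*_ to _*R_; _-_ to _-R_)

  -- sequences indexed from 1 (the value at 0 is irrelevant)
  Seq : Set c
  Seq = ℕ → Carrier

  SeqEq : Seq → Seq → Set ℓ
  SeqEq u v = ∀ n → u (suc n) ≈ v (suc n)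

  IsAutomatic : (p : ℕ) .{{_ : NonZero p}} → Seq → Set (c ⊔ ℓ)
  IsAutomatic p a = Σ (Automaton p Carrier) λ M → ∀ n → a (suc n) ≈ Automaton.output M (suc n)

  sub : (p : ℕ) → Seq → ℕ → ℕ → Seq
  sub p a i j n = a (p ^ i * n + j)

  InKernel : (p : ℕ) → Seq → Seq → Set ℓ
  InKernel p a u = ∃ λ i → ∃ λ j → j < p ^ i × SeqEq u (sub p a i j)

  tr : (p : ℕ) → Seq → Fin p → Seq
  tr p u i n = u (p * n + toℕ i)

  -- u : Fin K → Seq is an enumeration without repetition of N(a)
  IsKernelEnum : (p : ℕ) → Seq → (K : ℕ) → (Fin K → Seq) → Set ℓ
  IsKernelEnum p a K u =
      (∀ k → InKernel p a (u k))
    × (∀ i j → j < p ^ i → ∃ λ k → SeqEq (u k) (sub p a i j))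
    × (∀ k l → SeqEq (u k) (u l) → k ≡ l)

  -- s describes the arrows of Γ(a): arrow i from u k goes to u (s k i)
  IsGraph : (p : ℕ) → (K : ℕ) → (Fin K → Seq) → (Fin K → Fin p → Fin K) → Set ℓ
  IsGraph p K u s = ∀ k i → SeqEq (u (s k i)) (tr p (u k) i)

  fromℕ : ℕ → Carrier
  fromℕ zero    = 0#
  fromℕ (suc n) = 1# +R fromℕ n

  sumℕ : ℕ → (ℕ → Carrier) → Carrier
  sumℕ zero    f = 0#
  sumℕ (suc n) f = f n +R sumℕ n f

  sumFin : (K : ℕ) → (Fin K → Carrier) → Carrier
  sumFin zero    f = 0#
  sumFin (suc K) f = f fzero +R sumFin K (λ k → f (fsuc k))

  adjacency : (p K : ℕ) → (Fin K → Fin p → Fin K) → Fin K → Fin K → ℕ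
  adjacency p K s k l = countIdx (s k) l

  Tvec : (p : ℕ) → Seq → Carrier
  Tvec p u = sumℕ p (λ n → if does (n Data.Nat.≟ 0) then 0# else u n)

  -- formal power series in x over R: coefficient sequences
  PS : Set c
  PS = ℕ → Carrier

  xmul : PS → PS
  xmul f zero    = 0#
  xmul f (suc m) = f m

  constPS : Carrier → PS
  constPS r zero    = r
  constPS r (suc m) = 0#

  -- L(a,x) = Σ_{n ≥ 1} a_n x^{ℓ(n)}; coefficient of x^k is the (finite)
  -- sum of a_n over n ≥ 1 with ℓ(n) = k, all such n satisfy n < p^k.
  Lseries : (p : ℕ) .{{_ : NonZero p}} → Seq → PS
  Lseries p a k = sumℕ (p ^ k) (λ m → if does (numDigits p (suc m) Data.Nat.≟ k) then a (suc m) else 0#)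

  -- F : vector (indexed by Fin K) of power series solves (I - x A) F = x T,
  -- coefficientwise, where A is a ℕ-matrix and T a vector over R.
  SolvesSystem : (K : ℕ) → (Fin K → Fin K → ℕ) → (Fin K → Carrier) → (Fin K → PS) → Set ℓ
  SolvesSystem K A T F =
    ∀ k m → F k m -R xmul (λ m' → sumFin K (λ l → fromℕ (A k l) *R F l m')) m
            ≈ xmul (constPS (T k)) m

-- Write L(u) = Σ_{n ≥ 1} u_n x^{ℓ(n)}. Its constant term is 0 and its coefficient of x is
-- u_1 + ⋯ + u_{p-1} = T_u. An integer n ≥ p is uniquely pn' + i with n' ≥ 1 and i < p, and
-- then ℓ(n) = ℓ(n') + 1, so the coefficient of x^{k+2} in L(u) is Σ_{i<p} of the coefficient
-- of x^{k+1} in L(u^{t_i}). Grouping the t_i-successors of u_k by their target, this says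
-- that the vector (L(u_k))_k satisfies F = xT + xAF. That system determines the coefficient
-- of x^{m+1} of F from the coefficients of x^m, so its solution is unique.
module Submission where

open import Defs
open import Level using (Level)
open import Algebra.Bundles using (CommutativeRing)
open import Data.Nat using (ℕ; zero; suc; _≤_; _<_; z≤n; s≤s; NonZero)
import Data.Nat as Nat
open import Data.Nat.Properties
  using (≤-refl; ≤-trans; ≤-pred; ≤-reflexive; m<n⇒m<1+n; m≤m*n; m≤m+n; m^n>0; 1+n≢n)
import Data.Nat.Properties as NatP
open import Data.Nat.DivMod using (_/_; m/n<m; m*n/n≡m; m<n⇒m/n≡0; +-distrib-/-∣ˡ)
open import Data.Nat.Divisibility using (m∣m*n)
open import Data.Fin using (Fin; toℕ) renaming (zero to fzero; suc to fsuc)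
import Data.Fin.Properties as Fin
open import Data.Product using (Σ; _×_; _,_)
open import Data.Bool using (true; false; if_then_else_)
open import Relation.Nullary using (does)
open import Relation.Nullary.Decidable using (dec-true; dec-false)
open import Relation.Binary.PropositionalEquality as ≡ using (_≡_; _≢_; cong)

module DigitCount (p : ℕ) .{{_ : NonZero p}} (2≤p : 2 ≤ p) where
  open Nat using (_+_; _*_; _^_)
  open ≡.≡-Reasoning

  0<p : 0 < p
  0<p = ≤-trans (s≤s z≤n) 2≤p

  suc[n]/p≤n : ∀ n → suc n / p ≤ n
  suc[n]/p≤n n = ≤-pred (m/n<m (suc n) p 2≤p)

  [p*q]/p≡q : ∀ q → p * q / p ≡ q
  [p*q]/p≡q q = ≡.trans (cong (_/ p) (NatP.*-comm p q)) (m*n/n≡m q p)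

  [p*q+i]/p≡q : ∀ q {i} → i < p → (p * q + i) / p ≡ q
  [p*q+i]/p≡q q {i} i<p = begin
    (p * q + i) / p    ≡⟨ +-distrib-/-∣ˡ i (m∣m*n q) ⟩
    p * q / p + i / p  ≡⟨ ≡.cong₂ _+_ ([p*q]/p≡q q) (m<n⇒m/n≡0 i<p) ⟩
    q + 0              ≡⟨ NatP.+-identityʳ q ⟩
    q                  ∎

  lenFuel-irrelevant : ∀ f g n → n ≤ f → n ≤ g → lenFuel p f n ≡ lenFuel p g n
  lenFuel-irrelevant zero    zero    zero    _       _       = ≡.refl
  lenFuel-irrelevant zero    (suc g) zero    _       _       = ≡.refl
  lenFuel-irrelevant (suc f) zero    zero    _       _       = ≡.refl
  lenFuel-irrelevant (suc f) (suc g) zero    _       _       = ≡.refl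
  lenFuel-irrelevant (suc f) (suc g) (suc n) (s≤s n≤f) (s≤s n≤g) =
    cong suc (lenFuel-irrelevant f g (suc n / p)
               (≤-trans (suc[n]/p≤n n) n≤f) (≤-trans (suc[n]/p≤n n) n≤g))

  numDigits-pos : ∀ {n} → 0 < n → numDigits p n ≡ suc (numDigits p (n / p))
  numDigits-pos {suc n} _ =
    cong suc (lenFuel-irrelevant n (suc n / p) (suc n / p) (suc[n]/p≤n n) ≤-refl)

  numDigits-nonzeroDigit : ∀ d → suc d < p → numDigits p (suc d) ≡ 1
  numDigits-nonzeroDigit d d<p =
    ≡.trans (numDigits-pos (s≤s z≤n)) (cong (λ n → suc (numDigits p n)) (m<n⇒m/n≡0 d<p))

  numDigits-digit : ∀ {i} → i < p → numDigits p i ≤ 1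
  numDigits-digit {zero}  _   = z≤n
  numDigits-digit {suc d} d<p = ≤-reflexive (numDigits-nonzeroDigit d d<p)

  numDigits-p*q+i : ∀ q {i} → i < p → numDigits p (p * suc q + i) ≡ suc (numDigits p (suc q))
  numDigits-p*q+i q {i} i<p =
    ≡.trans (numDigits-pos 0<n) (cong (λ n → suc (numDigits p n)) ([p*q+i]/p≡q (suc q) i<p))
    where
    0<n : 0 < p * suc q + i
    0<n = ≤-trans 0<p (≤-trans (m≤m*n p (suc q)) (m≤m+n (p * suc q) i))

  numDigits-^ : ∀ k → numDigits p (p ^ k) ≡ suc k
  numDigits-^ zero    = ≡.refl
  numDigits-^ (suc k) = begin
    numDigits p (p ^ suc k)               ≡⟨ numDigits-pos (m^n>0 p (suc k)) ⟩
    suc (numDigits p (p * p ^ k / p))     ≡⟨ cong (λ n → suc (numDigits p n)) ([p*q]/p≡q (p ^ k)) ⟩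
    suc (numDigits p (p ^ k))             ≡⟨ cong suc (numDigits-^ k) ⟩
    suc (suc k)                           ∎

module FiniteSums {c ℓ : Level} (R : CommutativeRing c ℓ) where
  open CommutativeRing R
  open import Algebra.Properties.CommutativeMonoid.Sum +-commutativeMonoid
    using (sum; sum-cong-≋; sum-replicate-zero; ∑-distrib-+)
  open import Algebra.Properties.CommutativeSemigroup +-commutativeSemigroup
    using (interchange; x∙yz≈y∙xz)
  open import Relation.Binary.Reasoning.Setoid setoid

  sumℕ-cong< : ∀ N {f g} → (∀ n → n < N → f n ≈ g n) → sumℕ R N f ≈ sumℕ R N g
  sumℕ-cong< zero    f≈g = refl
  sumℕ-cong< (suc N) f≈g = +-cong (f≈g N ≤-refl) (sumℕ-cong< N (λ n n<N → f≈g n (m<n⇒m<1+n n<N)))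

  sumℕ-cong : ∀ N {f g} → (∀ n → f n ≈ g n) → sumℕ R N f ≈ sumℕ R N g
  sumℕ-cong N f≈g = sumℕ-cong< N (λ n _ → f≈g n)

  sumℕ-zero : ∀ N → sumℕ R N (λ _ → 0#) ≈ 0#
  sumℕ-zero zero    = refl
  sumℕ-zero (suc N) = trans (+-identityˡ _) (sumℕ-zero N)

  sumℕ-suc : ∀ N f → sumℕ R (suc N) f ≈ f 0 + sumℕ R N (λ n → f (suc n))
  sumℕ-suc zero    f = refl
  sumℕ-suc (suc N) f = trans (+-congˡ (sumℕ-suc N f)) (x∙yz≈y∙xz _ _ _)

  sumℕ-+ : ∀ M N f → sumℕ R (M Nat.+ N) f ≈ sumℕ R M (λ i → f (N Nat.+ i)) + sumℕ R N f
  sumℕ-+ zero    N f = sym (+-identityˡ _)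
  sumℕ-+ (suc M) N f =
    trans (+-cong (reflexive (cong f (NatP.+-comm M N))) (sumℕ-+ M N f)) (sym (+-assoc _ _ _))

  sumℕ-blocks : ∀ p N f →
    sumℕ R (p Nat.* N) f ≈ sumℕ R N (λ q → sumℕ R p (λ i → f (p Nat.* q Nat.+ i)))
  sumℕ-blocks p zero    f rewrite NatP.*-zeroʳ p = refl
  sumℕ-blocks p (suc N) f rewrite NatP.*-suc p N =
    trans (sumℕ-+ p (p Nat.* N) f) (+-congˡ (sumℕ-blocks p N f))

  sumℕ-distrib-+ : ∀ N f g → sumℕ R N (λ n → f n + g n) ≈ sumℕ R N f + sumℕ R N g
  sumℕ-distrib-+ zero    f g = sym (+-identityˡ _)
  sumℕ-distrib-+ (suc N) f g = trans (+-congˡ (sumℕ-distrib-+ N f g)) (interchange _ _ _ _)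

  sumℕ-comm : ∀ M N (g : ℕ → ℕ → Carrier) →
              sumℕ R M (λ i → sumℕ R N (g i)) ≈ sumℕ R N (λ j → sumℕ R M (λ i → g i j))
  sumℕ-comm M zero    g = sumℕ-zero M
  sumℕ-comm M (suc N) g =
    trans (sumℕ-distrib-+ M (λ i → g i N) (λ i → sumℕ R N (g i))) (+-congˡ (sumℕ-comm M N g))

  sumFin≈sumℕ : ∀ N g → sumFin R N (λ i → g (toℕ i)) ≈ sumℕ R N g
  sumFin≈sumℕ zero    g = refl
  sumFin≈sumℕ (suc N) g = trans (+-congˡ (sumFin≈sumℕ N (λ n → g (suc n)))) (sym (sumℕ-suc N g))

  sumFin≡sum : ∀ K f → sumFin R K f ≡ sum f
  sumFin≡sum zero    f = ≡.refl
  sumFin≡sum (suc K) f = cong (f fzero +_) (sumFin≡sum K (λ k → f (fsuc k)))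

  sumFin-cong : ∀ K {f g} → (∀ k → f k ≈ g k) → sumFin R K f ≈ sumFin R K g
  sumFin-cong K {f} {g} f≈g rewrite sumFin≡sum K f | sumFin≡sum K g = sum-cong-≋ f≈g

  sumFin-zero : ∀ K {f} → (∀ k → f k ≈ 0#) → sumFin R K f ≈ 0#
  sumFin-zero K f≈0 =
    trans (sumFin-cong K f≈0) (trans (reflexive (sumFin≡sum K _)) (sum-replicate-zero K))

  sumFin-distrib-+ : ∀ K f g → sumFin R K (λ k → f k + g k) ≈ sumFin R K f + sumFin R K g
  sumFin-distrib-+ K f g
    rewrite sumFin≡sum K (λ k → f k + g k) | sumFin≡sum K f | sumFin≡sum K g = ∑-distrib-+ f g

  sumFin-indicator : ∀ K (x : Fin K) (H : Fin K → Carrier) →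
    sumFin R K (λ l → fromℕ R (if does (x Fin.≟ l) then 1 else 0) * H l) ≈ H x
  sumFin-indicator (suc K) fzero H =
    trans (+-cong (trans (*-congʳ (+-identityʳ 1#)) (*-identityˡ _))
                  (sumFin-zero K (λ _ → zeroˡ _)))
          (+-identityʳ _)
  sumFin-indicator (suc K) (fsuc x) H =
    trans (+-cong (zeroˡ _) (sumFin-indicator K x (λ l → H (fsuc l)))) (+-identityˡ _)

  fromℕ-+ : ∀ m n → fromℕ R (m Nat.+ n) ≈ fromℕ R m + fromℕ R n
  fromℕ-+ zero    n = sym (+-identityˡ _)
  fromℕ-+ (suc m) n = trans (+-congˡ (fromℕ-+ m n)) (sym (+-assoc _ _ _))

  sumFin-countIdx : ∀ P K (s : Fin P → Fin K) (H : Fin K → Carrier) →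
    sumFin R K (λ l → fromℕ R (countIdx s l) * H l) ≈ sumFin R P (λ i → H (s i))
  sumFin-countIdx zero    K s H = sumFin-zero K (λ _ → zeroˡ _)
  sumFin-countIdx (suc P) K s H = begin
    sumFin R K (λ l → fromℕ R (countIdx s l) * H l)
      ≈⟨ sumFin-cong K (λ l → trans (*-congʳ (fromℕ-+ (δ l) (rest l))) (distribʳ _ _ _)) ⟩
    sumFin R K (λ l → fromℕ R (δ l) * H l + fromℕ R (rest l) * H l)
      ≈⟨ sumFin-distrib-+ K _ _ ⟩
    sumFin R K (λ l → fromℕ R (δ l) * H l) + sumFin R K (λ l → fromℕ R (rest l) * H l)
      ≈⟨ +-cong (sumFin-indicator K (s fzero) H) (sumFin-countIdx P K (λ i → s (fsuc i)) H) ⟩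
    H (s fzero) + sumFin R P (λ i → H (s (fsuc i)))
      ∎
    where
    δ rest : Fin K → ℕ
    δ l = if does (s fzero Fin.≟ l) then 1 else 0
    rest = countIdx (λ i → s (fsuc i))

module SystemSolutions {c ℓ : Level} (R : CommutativeRing c ℓ)
  {K : ℕ} (A : Fin K → Fin K → ℕ) (T : Fin K → CommutativeRing.Carrier R) where
  open CommutativeRing R
  open import Algebra.Properties.Ring ring using (//-rightDividesˡ)
  open FiniteSums R using (sumFin-cong)

  solvesSystem-unfold : ∀ {F} → SolvesSystem R K A T F → ∀ k m →
    F k m ≈ xmul R (constPS R (T k)) m
          + xmul R (λ m' → sumFin R K (λ l → fromℕ R (A k l) * F l m')) m
  solvesSystem-unfold F-sol k m = trans (sym (//-rightDividesˡ _ _)) (+-congʳ (F-sol k m))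

  solvesSystem-unique : ∀ {F G} → SolvesSystem R K A T F → SolvesSystem R K A T G →
                        ∀ m k → F k m ≈ G k m
  solvesSystem-unique F-sol G-sol zero k =
    trans (solvesSystem-unfold F-sol k 0) (sym (solvesSystem-unfold G-sol k 0))
  solvesSystem-unique F-sol G-sol (suc m) k =
    trans (solvesSystem-unfold F-sol k (suc m))
          (trans (+-congˡ (sumFin-cong K (λ l → *-congˡ (solvesSystem-unique F-sol G-sol m l))))
                 (sym (solvesSystem-unfold G-sol k (suc m))))

module LengthSeries {c ℓ : Level} (R : CommutativeRing c ℓ)
  (p : ℕ) .{{_ : NonZero p}} (2≤p : 2 ≤ p) where
  open CommutativeRing R
  open import Algebra.Properties.Ring ring using (-0#≈0#; x≈y⇒x∙y⁻¹≈ε)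
  open import Relation.Binary.Reasoning.Setoid setoid
  open FiniteSums R
  open DigitCount p 2≤p

  atLength : ℕ → Seq R → Seq R
  atLength k u n = if does (numDigits p n Nat.≟ k) then u n else 0#

  atLength-≡ : ∀ {k u n} → numDigits p n ≡ k → atLength k u n ≈ u n
  atLength-≡ {k} {u} {n} ℓ≡k =
    reflexive (cong (if_then u n else 0#) (dec-true (numDigits p n Nat.≟ k) ℓ≡k))

  atLength-≢ : ∀ {k u n} → numDigits p n ≢ k → atLength k u n ≈ 0#
  atLength-≢ {k} {u} {n} ℓ≢k =
    reflexive (cong (if_then u n else 0#) (dec-false (numDigits p n Nat.≟ k) ℓ≢k))

  atLength-cong : ∀ {k u v n} → u n ≈ v n → atLength k u n ≈ atLength k v n
  atLength-cong {k} {u} {v} {n} uₙ≈vₙ = select (does (numDigits p n Nat.≟ k))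
    where
    select : ∀ b → (if b then u n else 0#) ≈ (if b then v n else 0#)
    select true  = uₙ≈vₙ
    select false = refl

  atLength-p*q+i : ∀ j u q {i} → i < p →
    atLength (suc (suc j)) u (p Nat.* q Nat.+ i) ≈ atLength (suc j) (λ n → u (p Nat.* n Nat.+ i)) q
  atLength-p*q+i j u zero {i} i<p rewrite NatP.*-zeroʳ p =
    atLength-≢ {u = u} (NatP.<⇒≢ (s≤s (≤-trans (numDigits-digit i<p) (s≤s z≤n))))
  atLength-p*q+i j u (suc q) i<p rewrite numDigits-p*q+i q i<p = refl

  Lseries-cong : ∀ u v → SeqEq R u v → ∀ k → Lseries R p u k ≈ Lseries R p v k
  Lseries-cong u v u≈v k = sumℕ-cong (p Nat.^ k) (λ m → atLength-cong {k} {u} {v} (u≈v m))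

  Lseries-zero : ∀ u → Lseries R p u 0 ≈ 0#
  Lseries-zero u = +-identityʳ 0#

  -- Lseries runs over 1 ≤ n ≤ p^k; for k ≥ 1, dropping n = p^k (of length k + 1) and adding
  -- n = 0 (of length 0) changes nothing.
  Lseries-suc : ∀ u k → Lseries R p u (suc k) ≈ sumℕ R (p Nat.^ suc k) (atLength (suc k) u)
  Lseries-suc u k = begin
    Lseries R p u (suc k)                              ≈⟨ +-identityˡ _ ⟨
    0# + Lseries R p u (suc k)                         ≈⟨ sumℕ-suc N (atLength (suc k) u) ⟨
    atLength (suc k) u N + sumℕ R N (atLength (suc k) u)
      ≈⟨ +-congʳ (atLength-≢ {u = u} (λ e → 1+n≢n (≡.trans (≡.sym (numDigits-^ (suc k))) e))) ⟩
    0# + sumℕ R N (atLength (suc k) u)                 ≈⟨ +-identityˡ _ ⟩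
    sumℕ R N (atLength (suc k) u)                      ∎
    where
    N = p Nat.^ suc k

  Lseries-one : ∀ u → Lseries R p u 1 ≈ Tvec R p u
  Lseries-one u = begin
    Lseries R p u 1                   ≈⟨ Lseries-suc u 0 ⟩
    sumℕ R (p Nat.^ 1) (atLength 1 u) ≡⟨ cong (λ N → sumℕ R N (atLength 1 u)) (NatP.*-identityʳ p) ⟩
    sumℕ R p (atLength 1 u)           ≈⟨ sumℕ-cong< p digit ⟩
    Tvec R p u                        ∎
    where
    digit : ∀ i → i < p → atLength 1 u i ≈ (if does (i Nat.≟ 0) then 0# else u i)
    digit zero    _   = refl
    digit (suc d) d<p = atLength-≡ {u = u} (numDigits-nonzeroDigit d d<p)

  Lseries-suc-suc : ∀ u j →
    Lseries R p u (suc (suc j)) ≈ sumFin R p (λ i → Lseries R p (tr R p u i) (suc j))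
  Lseries-suc-suc u j = begin
    Lseries R p u (suc (suc j))
      ≈⟨ Lseries-suc u (suc j) ⟩
    sumℕ R (p Nat.* N) (atLength (suc (suc j)) u)
      ≈⟨ sumℕ-blocks p N _ ⟩
    sumℕ R N (λ q → sumℕ R p (λ i → atLength (suc (suc j)) u (p Nat.* q Nat.+ i)))
      ≈⟨ sumℕ-cong N (λ q → sumℕ-cong< p (λ i → atLength-p*q+i j u q)) ⟩
    sumℕ R N (λ q → sumℕ R p (λ i → atLength (suc j) (t i) q))
      ≈⟨ sumℕ-comm N p _ ⟩
    sumℕ R p (λ i → sumℕ R N (atLength (suc j) (t i)))
      ≈⟨ sumℕ-cong p (λ i → Lseries-suc (t i) j) ⟨
    sumℕ R p (λ i → Lseries R p (t i) (suc j))
      ≈⟨ sumFin≈sumℕ p _ ⟨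
    sumFin R p (λ i → Lseries R p (tr R p u i) (suc j))
      ∎
    where
    N = p Nat.^ suc j
    t : ℕ → Seq R
    t i n = u (p Nat.* n Nat.+ i)

  x-0#≈x : ∀ {x} → x - 0# ≈ x
  x-0#≈x = trans (+-congˡ -0#≈0#) (+-identityʳ _)

  Lseries-solvesSystem : ∀ K (u : Fin K → Seq R) s → IsGraph R p K u s →
    SolvesSystem R K (adjacency R p K s) (λ k → Tvec R p (u k)) (λ k → Lseries R p (u k))
  Lseries-solvesSystem K u s graph k zero = trans x-0#≈x (Lseries-zero (u k))
  Lseries-solvesSystem K u s graph k (suc zero) =
    trans (+-congˡ (-‿cong (sumFin-zero K (λ l → trans (*-congˡ (Lseries-zero (u l))) (zeroʳ _)))))
          (trans x-0#≈x (Lseries-one (u k)))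
  Lseries-solvesSystem K u s graph k (suc (suc j)) = x≈y⇒x∙y⁻¹≈ε (begin
    Lseries R p (u k) (suc (suc j))
      ≈⟨ Lseries-suc-suc (u k) j ⟩
    sumFin R p (λ i → Lseries R p (tr R p (u k) i) (suc j))
      ≈⟨ sumFin-cong p (λ i → Lseries-cong (u (s k i)) (tr R p (u k) i) (graph k i) (suc j)) ⟨
    sumFin R p (λ i → Lseries R p (u (s k i)) (suc j))
      ≈⟨ sumFin-countIdx p K (s k) (λ l → Lseries R p (u l) (suc j)) ⟨
    sumFin R K (λ l → fromℕ R (adjacency R p K s k l) * Lseries R p (u l) (suc j))
      ∎)

-- Only the closure of u under the t_i (witnessed by s) is used: the series L(u_k) solve the
-- system for any such finite family.
mainTheorem9 : {c ℓ : Level} (R : CommutativeRing c ℓ)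
  (p : ℕ) .{{_ : NonZero p}} → 2 ≤ p →
  (a : Seq R) → IsAutomatic R p a →
  (K : ℕ) (u : Fin K → Seq R) → IsKernelEnum R p a K u →
  (s : Fin K → Fin p → Fin K) → IsGraph R p K u s →
  (k₀ : Fin K) → SeqEq R (u k₀) a →
  Σ (Fin K → PS R) (λ F → SolvesSystem R K (adjacency R p K s) (λ k → Tvec R p (u k)) F)
  × ((F : Fin K → PS R) →
     SolvesSystem R K (adjacency R p K s) (λ k → Tvec R p (u k)) F →
     ∀ m → CommutativeRing._≈_ R (F k₀ m) (Lseries R p a m))
mainTheorem9 R p 2≤p a _ K u _ s graph k₀ u₀≈a = (L , L-solves) , L-unique
  where
  open CommutativeRing R using (trans)
  open LengthSeries R p 2≤p using (Lseries-solvesSystem; Lseries-cong)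
  open SystemSolutions R (adjacency R p K s) (λ k → Tvec R p (u k)) using (solvesSystem-unique)

  L : Fin K → PS R
  L k = Lseries R p (u k)

  L-solves : SolvesSystem R K (adjacency R p K s) (λ k → Tvec R p (u k)) L
  L-solves = Lseries-solvesSystem K u s graph

  L-unique : (F : Fin K → PS R) → SolvesSystem R K (adjacency R p K s) (λ k → Tvec R p (u k)) F →
             ∀ m → CommutativeRing._≈_ R (F k₀ m) (Lseries R p a m)
  L-unique F F-solves m =
    trans (solvesSystem-unique F-solves L-solves m k₀) (Lseries-cong (u k₀) a u₀≈a m)
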